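{- Consider the 2-element subsets $\Pi\subseteq S_3$ with $\Pi\neq\{123,321\}$, and call two such subsets $\Pi,\Pi'$ ch-Wilf equivalent if $Ch_n(\Pi;q)=Ch_n(\Pi';q)$ for all $n\ge0$. Then the ch-Wilf equivalence class of $\{132,213\}$ among these subsets is $\{\{132,213\},\{213,312\},\{132,231\},\{231,312\}\}$, and every other such subset is ch-Wilf equivalent to no other such subset (its class contains only itself).
   Context: $S_n$ is the set of permutations of $[n]$ in one-line notation. A permutation $\pi$ avoids $\sigma$ if no subsequence of $\pi$ is order isomorphic to $\sigma$; for a set $\Pi$ of permutations, $Av_n(\Pi)$ is the set of permutations in $S_n$ avoiding every element of $\Pi$. For $\pi\in S_n$, the charge value of $i\in[n]$ is: $chv(1)=0$; for $i\ge2$, $chv(i)=0$ if $i$ is to the right of $i-1$ in $\pi$ and $chv(i)=n+1-i$ if $i$ is to the left of $i-1$ in $\pi$; the charge is $ch(\pi)=\sum_{i=1}^n chv(i)$. Define $Ch_n(\Pi;q)=\sum_{\sigma\in Av_n(\Pi)} q^{ch(\sigma)}$. -}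

module Defs where

open import Data.Nat using (ℕ; zero; suc; _+_; _∸_; _<ᵇ_; _≡ᵇ_)
open import Data.Bool using (Bool; true; false; _∧_; _∨_; not; if_then_else_)
open import Data.List using (List; []; _∷_; map; filter; length; concatMap; upTo; zip)
open import Data.Bool.ListAction using (all; any)
open import Data.Nat.ListAction using (sum)
open import Data.Product using (_×_; _,_)
open import Data.Sum using (_⊎_)
open import Relation.Binary.PropositionalEquality using (_≡_)
open import Relation.Nullary.Decidable using (Dec; yes; no)
open import Data.Bool.Properties using () renaming (_≟_ to _≟ᵇ_)

Perm : Set
Perm = List ℕ

oneTo : ℕ → List ℕ
oneTo n = map suc (upTo n)

words : List ℕ → ℕ → List (List ℕ)
words as zero    = [] ∷ []
words as (suc k) = concatMap (λ a → map (a ∷_) (words as k)) as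

elemᵇ : ℕ → List ℕ → Bool
elemᵇ x []       = false
elemᵇ x (y ∷ ys) = (x ≡ᵇ y) ∨ elemᵇ x ys

distinctᵇ : List ℕ → Bool
distinctᵇ []       = true
distinctᵇ (x ∷ xs) = not (elemᵇ x xs) ∧ distinctᵇ xs

S : ℕ → List Perm
S n = filter (λ w → distinctᵇ w ≟ᵇ true) (words (oneTo n) n)

subseqs : List ℕ → List (List ℕ)
subseqs []       = [] ∷ []
subseqs (x ∷ xs) = map (x ∷_) (subseqs xs) Data.List.++ subseqs xs

orderIsoᵇ : List ℕ → List ℕ → Bool
orderIsoᵇ a b =
  (length a ≡ᵇ length b) ∧
  all (λ p → all (λ r → sameCmp p r) ab) ab
  where
  ab = zip a b
  sameCmp : ℕ × ℕ → ℕ × ℕ → Bool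
  sameCmp (x , y) (x' , y') = (x <ᵇ x') ≡ᵇᵇ (y <ᵇ y')
    where
    _≡ᵇᵇ_ : Bool → Bool → Bool
    true  ≡ᵇᵇ c = c
    false ≡ᵇᵇ c = not c

containsᵇ : Perm → Perm → Bool
containsᵇ σ π = any (orderIsoᵇ σ) (subseqs π)

avoidsAllᵇ : List Perm → Perm → Bool
avoidsAllᵇ Π π = all (λ σ → not (containsᵇ σ π)) Π

-- position (0-based) of x in a list (length of list if absent)
pos : ℕ → List ℕ → ℕ
pos x []       = 0
pos x (y ∷ ys) = if x ≡ᵇ y then 0 else suc (pos x ys)

chv : ℕ → Perm → ℕ → ℕ
chv n π zero          = 0
chv n π (suc zero)    = 0
chv n π (suc (suc j)) =
  -- i = j+2, i-1 = j+1 ; i to the left of i-1  ↦  n+1-i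
  if pos (suc (suc j)) π <ᵇ pos (suc j) π then suc n ∸ suc (suc j) else 0

ch : Perm → ℕ
ch π = sum (map (chv (length π) π) (oneTo (length π)))

-- coefficient of q^k in Ch_n(Π;q) = #{σ ∈ Av_n(Π) : ch σ = k}
ChCoeff : ℕ → List Perm → ℕ → ℕ
ChCoeff n Π k =
  length (filter (λ σ → (avoidsAllᵇ Π σ ∧ (ch σ ≡ᵇ k)) ≟ᵇ true) (S n))

-- ch-Wilf equivalence: Ch_n(Π;q) = Ch_n(Π';q) for all n ≥ 0
-- (equality of polynomials in q = equality of all coefficients)
ChWilfEquiv : List Perm → List Perm → Set
ChWilfEquiv Π Π' = ∀ n k → ChCoeff n Π k ≡ ChCoeff n Π' k

SameSet : Perm → Perm → Perm → Perm → Set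
SameSet a b c d = (a ≡ c × b ≡ d) ⊎ (a ≡ d × b ≡ c)

p123 p132 p213 p231 p312 p321 : Perm
p123 = 1 ∷ 2 ∷ 3 ∷ []
p132 = 1 ∷ 3 ∷ 2 ∷ []
p213 = 2 ∷ 1 ∷ 3 ∷ []
p231 = 2 ∷ 3 ∷ 1 ∷ []
p312 = 3 ∷ 1 ∷ 2 ∷ []
p321 = 3 ∷ 2 ∷ 1 ∷ []

InClass : Perm → Perm → Set
InClass a b = SameSet a b p132 p213 ⊎ SameSet a b p213 p312
            ⊎ SameSet a b p132 p231 ⊎ SameSet a b p231 p312

-- Inserting the maximum n + 2 into a permutation τ of [n + 1] raises by one the charge value of every i
-- standing left of i − 1, and n + 2 itself gets charge value b = 1 or 0 according as it lands left or
-- right of n + 1.  So with ides τ the number of such i, (ch, ides) grows by (ides τ + b, b).  For each of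
-- the pairs {132,213}, {213,312}, {132,231}, {231,312}, every avoider of length n + 2 comes from a unique
-- avoider of length n + 1 by one of exactly two insertions, one with b = 1 (at the front, or just before
-- n + 1) and one with b = 0 (at the back, or just after n + 1).  Hence (ch, ides), and so Ch_n, has the
-- same distribution on the four classes.  The eleven classes are then told apart by three coefficients
-- of Ch_3 and Ch_4.

module Submission where

open import Data.Bool using (Bool; true; false; T; not; _∧_; if_then_else_)
open import Data.Bool.ListAction using (all)
open import Data.Bool.Properties using (T-∧; T-∨; T-≡; T-not-≡) renaming (_≟_ to _≟ᵇ_)
open import Data.Empty using (⊥-elim)
open import Data.List using (List; []; _∷_; [_]; _++_; length; map; zip; concatMap; upTo; filter)
open import Data.List.Membership.Propositional using (_∈_; _∉_; find; lose)
open import Data.List.Membership.Propositional.Properties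
  using (∈-++⁺ˡ; ∈-++⁺ʳ; ∈-++⁻; ∈-map⁺; ∈-map⁻; ∈-concatMap⁺; ∈-concatMap⁻; ∈-upTo⁻; ∈-∃++; ∈-filter⁺; ∈-filter⁻)
open import Data.List.Membership.Propositional.Properties.WithK using (unique∧set⇒bag)
open import Data.List.Properties
  using (∷-injectiveˡ; ∷-injectiveʳ; ++-assoc; ++-identityʳ; map-++; map-∘; map-cong; map-cong-local;
         length-map; length-upTo; length-++-sucʳ; applyUpTo-∷ʳ; filter-≐)
open import Data.List.Relation.Binary.BagAndSetEquality using (∼bag⇒↭)
open import Data.List.Relation.Binary.Disjoint.Propositional using (Disjoint)
open import Data.List.Relation.Binary.Permutation.Propositional
  using (_↭_; prep; ↭-refl; ↭-sym; ↭⇒↭ₛ; module PermutationReasoning)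
open import Data.List.Relation.Binary.Permutation.Propositional.Properties
  using (∈-resp-↭; shift; ++-comm; drop-mid; ↭-length; ↭-empty-inv; ↭-singleton-inv)
open import Data.List.Relation.Binary.Sublist.Propositional using (_⊆_; []; _∷_; _∷ʳ_; lookup; from∈; ⊆-refl; ⊆-trans)
open import Data.List.Relation.Binary.Sublist.Propositional.Properties using ([]⊆-universal; ++⁺; length-mono-≤)
open import Data.List.Relation.Unary.All using (All; []; _∷_)
import Data.List.Relation.Unary.All as All
open import Data.List.Relation.Unary.All.Properties using (all⁺; all⁻; ¬Any⇒All¬; All¬⇒¬Any) renaming (map⁺ to All-map⁺)
open import Data.List.Relation.Unary.Any using (here; there)
open import Data.List.Relation.Unary.Any.Properties using (any⁺; any⁻)
open import Data.List.Relation.Unary.Unique.Propositional using (Unique; []; _∷_)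
import Data.List.Relation.Unary.Unique.Propositional.Properties as Unique
open import Data.Maybe using (Maybe; just; nothing)
open import Data.Maybe.Properties using (just-injective)
open import Data.Nat using (ℕ; zero; suc; pred; _+_; _<_; _≤_; _<ᵇ_; _≡ᵇ_; z≤n; s≤s; z<s)
open import Data.Nat.ListAction using (sum)
open import Data.Nat.ListAction.Properties using (sum-++)
open import Data.Nat.Properties
  using (<ᵇ⇒<; ≡ᵇ⇒≡; ≡⇒≡ᵇ; suc-injective; ≤-refl; ≤-trans; ≤-pred; ≤-reflexive; <⇒≤; <⇒≢; <-trans; <-irrefl;
         <-asym; ≤∧≢⇒<; n≤1+n; n<1+n; n≮n; m≤n⇒m≤1+n; +-identityʳ; +-monoʳ-<; +-∸-assoc; m+n∸n≡m;
         +-commutativeSemigroup)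
open import Data.Product using (_×_; _,_; proj₁; proj₂; ∃; ∃₂; swap)
open import Data.Sum using (_⊎_; inj₁; inj₂; [_,_]′)
open import Function using (_∘_; id; case_of_; _⇔_; mk⇔; Equivalence)
open import Function.Properties.Equivalence using () renaming (trans to ⇔-trans)
open import Relation.Binary.PropositionalEquality
  using (_≡_; _≢_; refl; sym; trans; cong; cong₂; subst; setoid; module ≡-Reasoning)
open import Relation.Nullary using (¬_; Dec)

open import Algebra.Properties.CommutativeSemigroup +-commutativeSemigroup using () renaming (interchange to +-interchange)
open import Data.List.Relation.Binary.Permutation.Setoid.Properties (setoid ℕ) using (Unique-resp-↭)

open import Defs

-- Boolean reflection

<ᵇ-true : ∀ {m n} → m < n → (m <ᵇ n) ≡ true
<ᵇ-true {zero} {suc n} _ = refl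
<ᵇ-true {suc m} {suc n} (s≤s m<n) = <ᵇ-true m<n

<ᵇ-false : ∀ {m n} → n ≤ m → (m <ᵇ n) ≡ false
<ᵇ-false {m} {zero} _ = refl
<ᵇ-false {suc m} {suc n} (s≤s n≤m) = <ᵇ-false n≤m

n<ᵇn : ∀ n → (n <ᵇ n) ≡ false
n<ᵇn n = <ᵇ-false (≤-refl {n})

≡ᵇ-refl : ∀ n → (n ≡ᵇ n) ≡ true
≡ᵇ-refl n = Equivalence.to T-≡ (≡⇒≡ᵇ n n refl)

T-not : ∀ {b} → T (not b) ⇔ (¬ T b)
T-not {true} = mk⇔ (λ ()) (λ ¬t → ¬t _)
T-not {false} = mk⇔ (λ _ ()) (λ _ → _)

≡ᵇ-false : ∀ {m n} → m ≢ n → (m ≡ᵇ n) ≡ false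
≡ᵇ-false {m} {n} m≢n = Equivalence.to T-not-≡ (Equivalence.from T-not (m≢n ∘ ≡ᵇ⇒≡ m n))

T-elemᵇ : ∀ {x xs} → T (elemᵇ x xs) ⇔ x ∈ xs
T-elemᵇ {x} {xs} = mk⇔ (to xs) from
  where
  to : ∀ xs → T (elemᵇ x xs) → x ∈ xs
  to (y ∷ ys) h with Equivalence.to (T-∨ {x ≡ᵇ y}) h
  ... | inj₁ x≡y = here (≡ᵇ⇒≡ x y x≡y)
  ... | inj₂ x∈ys = there (to ys x∈ys)
  from : ∀ {xs} → x ∈ xs → T (elemᵇ x xs)
  from (here refl) = Equivalence.from T-∨ (inj₁ (≡⇒≡ᵇ x x refl))
  from (there x∈xs) = Equivalence.from T-∨ (inj₂ (from x∈xs))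

T-distinctᵇ : ∀ {xs} → T (distinctᵇ xs) ⇔ Unique xs
T-distinctᵇ {xs} = mk⇔ (to xs) from
  where
  to : ∀ xs → T (distinctᵇ xs) → Unique xs
  to [] _ = []
  to (x ∷ xs) h with Equivalence.to (T-∧ {not (elemᵇ x xs)}) h
  ... | x∉xs , u = ¬Any⇒All¬ xs (Equivalence.to T-not x∉xs ∘ Equivalence.from T-elemᵇ) ∷ to xs u
  from : ∀ {xs} → Unique xs → T (distinctᵇ xs)
  from [] = _
  from (x≢xs ∷ u) = Equivalence.from T-∧
    (Equivalence.from T-not (All¬⇒¬Any x≢xs ∘ Equivalence.to T-elemᵇ) , from u)

-- Occurrences of patterns

∈-subseqs⁺ : ∀ {xs ys} → xs ⊆ ys → xs ∈ subseqs ys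
∈-subseqs⁺ {ys = []} [] = here refl
∈-subseqs⁺ {ys = y ∷ ys} (.y ∷ʳ p) = ∈-++⁺ʳ (map (y ∷_) (subseqs ys)) (∈-subseqs⁺ p)
∈-subseqs⁺ (refl ∷ p) = ∈-++⁺ˡ (∈-map⁺ _ (∈-subseqs⁺ p))

∈-subseqs⁻ : ∀ {xs} ys → xs ∈ subseqs ys → xs ⊆ ys
∈-subseqs⁻ [] (here refl) = []
∈-subseqs⁻ (y ∷ ys) p with ∈-++⁻ (map (y ∷_) (subseqs ys)) p
... | inj₂ q = y ∷ʳ ∈-subseqs⁻ ys q
... | inj₁ q with ∈-map⁻ _ q
...   | _ , r , refl = refl ∷ ∈-subseqs⁻ ys r

record Pattern : Set₁ where
  field
    word        : Perm
    length-word : length word ≡ 3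
    Shape       : ℕ → ℕ → ℕ → Set
    iso⇒Shape   : ∀ {a b c} → T (orderIsoᵇ word (a ∷ b ∷ c ∷ [])) → Shape a b c
    Shape⇒iso   : ∀ {a b c} → Shape a b c → T (orderIsoᵇ word (a ∷ b ∷ c ∷ []))

open Pattern

data Occurs (P : Pattern) (π : Perm) : Set where
  occurs : ∀ {a b c} → a ∷ b ∷ c ∷ [] ⊆ π → Shape P a b c → Occurs P π

-- For a concrete pattern word, orderIsoᵇ reduces to a conjunction of agree over all pairs of positions,
-- so agree-at reads off single comparisons.
agree : ℕ × ℕ → ℕ × ℕ → Bool
agree (x , y) (x′ , y′) = if x <ᵇ x′ then y <ᵇ y′ else not (y <ᵇ y′)

agree-at : ∀ {p r} σ s → T (all (λ q → all (agree q) (zip σ s)) (zip σ s)) →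
           p ∈ zip σ s → r ∈ zip σ s → T (agree p r)
agree-at σ s h p∈ r∈ = All.lookup (all⁺ (agree _) _ (All.lookup (all⁺ _ _ h) p∈)) r∈

pattern 1st = here refl
pattern 2nd = there (here refl)
pattern 3rd = there (there (here refl))

132-Shape⇒iso : ∀ {a b c} → a < c × c < b → T (orderIsoᵇ p132 (a ∷ b ∷ c ∷ []))
132-Shape⇒iso {a} {b} {c} (a<c , c<b)
  rewrite <ᵇ-true a<c | <ᵇ-true c<b | <ᵇ-true (<-trans a<c c<b)
        | <ᵇ-false (<⇒≤ a<c) | <ᵇ-false (<⇒≤ c<b) | <ᵇ-false (<⇒≤ (<-trans a<c c<b))
        | n<ᵇn a | n<ᵇn b | n<ᵇn c = _

132-pattern : Pattern
132-pattern = record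
  { word = p132
  ; length-word = refl
  ; Shape = λ a b c → a < c × c < b
  ; iso⇒Shape = λ {a} {b} {c} h →
      <ᵇ⇒< a c (agree-at p132 (a ∷ b ∷ c ∷ []) h 1st 3rd) ,
      <ᵇ⇒< c b (agree-at p132 (a ∷ b ∷ c ∷ []) h 3rd 2nd)
  ; Shape⇒iso = 132-Shape⇒iso
  }

213-Shape⇒iso : ∀ {a b c} → b < a × a < c → T (orderIsoᵇ p213 (a ∷ b ∷ c ∷ []))
213-Shape⇒iso {a} {b} {c} (b<a , a<c)
  rewrite <ᵇ-true b<a | <ᵇ-true a<c | <ᵇ-true (<-trans b<a a<c)
        | <ᵇ-false (<⇒≤ b<a) | <ᵇ-false (<⇒≤ a<c) | <ᵇ-false (<⇒≤ (<-trans b<a a<c))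
        | n<ᵇn a | n<ᵇn b | n<ᵇn c = _

213-pattern : Pattern
213-pattern = record
  { word = p213
  ; length-word = refl
  ; Shape = λ a b c → b < a × a < c
  ; iso⇒Shape = λ {a} {b} {c} h →
      <ᵇ⇒< b a (agree-at p213 (a ∷ b ∷ c ∷ []) h 2nd 1st) ,
      <ᵇ⇒< a c (agree-at p213 (a ∷ b ∷ c ∷ []) h 1st 3rd)
  ; Shape⇒iso = 213-Shape⇒iso
  }

231-Shape⇒iso : ∀ {a b c} → c < a × a < b → T (orderIsoᵇ p231 (a ∷ b ∷ c ∷ []))
231-Shape⇒iso {a} {b} {c} (c<a , a<b)
  rewrite <ᵇ-true c<a | <ᵇ-true a<b | <ᵇ-true (<-trans c<a a<b)
        | <ᵇ-false (<⇒≤ c<a) | <ᵇ-false (<⇒≤ a<b) | <ᵇ-false (<⇒≤ (<-trans c<a a<b))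
        | n<ᵇn a | n<ᵇn b | n<ᵇn c = _

231-pattern : Pattern
231-pattern = record
  { word = p231
  ; length-word = refl
  ; Shape = λ a b c → c < a × a < b
  ; iso⇒Shape = λ {a} {b} {c} h →
      <ᵇ⇒< c a (agree-at p231 (a ∷ b ∷ c ∷ []) h 3rd 1st) ,
      <ᵇ⇒< a b (agree-at p231 (a ∷ b ∷ c ∷ []) h 1st 2nd)
  ; Shape⇒iso = 231-Shape⇒iso
  }

312-Shape⇒iso : ∀ {a b c} → b < c × c < a → T (orderIsoᵇ p312 (a ∷ b ∷ c ∷ []))
312-Shape⇒iso {a} {b} {c} (b<c , c<a)
  rewrite <ᵇ-true b<c | <ᵇ-true c<a | <ᵇ-true (<-trans b<c c<a)
        | <ᵇ-false (<⇒≤ b<c) | <ᵇ-false (<⇒≤ c<a) | <ᵇ-false (<⇒≤ (<-trans b<c c<a))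
        | n<ᵇn a | n<ᵇn b | n<ᵇn c = _

312-pattern : Pattern
312-pattern = record
  { word = p312
  ; length-word = refl
  ; Shape = λ a b c → b < c × c < a
  ; iso⇒Shape = λ {a} {b} {c} h →
      <ᵇ⇒< b c (agree-at p312 (a ∷ b ∷ c ∷ []) h 2nd 3rd) ,
      <ᵇ⇒< c a (agree-at p312 (a ∷ b ∷ c ∷ []) h 3rd 1st)
  ; Shape⇒iso = 312-Shape⇒iso
  }

orderIso-length : ∀ σ s → T (orderIsoᵇ σ s) → length σ ≡ length s
orderIso-length σ s h = ≡ᵇ⇒≡ _ _ (proj₁ (Equivalence.to (T-∧ {length σ ≡ᵇ length s}) h))

length≡3 : ∀ (s : List ℕ) → length s ≡ 3 → ∃ λ a → ∃₂ λ b c → s ≡ a ∷ b ∷ c ∷ []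
length≡3 (a ∷ b ∷ c ∷ []) refl = a , b , c , refl

contains⇔ : ∀ P π → T (containsᵇ (word P) π) ⇔ Occurs P π
contains⇔ P π = mk⇔ to from
  where
  to : T (containsᵇ (word P) π) → Occurs P π
  to h with s , s∈ , iso ← find (any⁻ _ (subseqs π) h)
    with _ , _ , _ , refl ← length≡3 s (trans (sym (orderIso-length (word P) s iso)) (length-word P)) =
    occurs (∈-subseqs⁻ π s∈) (iso⇒Shape P iso)
  from : Occurs P π → T (containsᵇ (word P) π)
  from (occurs s shape) = any⁺ _ (lose (∈-subseqs⁺ s) (Shape⇒iso P shape))

¬contains⇔ : ∀ P π → T (not (containsᵇ (word P) π)) ⇔ (¬ Occurs P π)
¬contains⇔ P π = mk⇔
  (λ h → Equivalence.to T-not h ∘ Equivalence.from (contains⇔ P π))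
  (λ ¬o → Equivalence.from T-not (¬o ∘ Equivalence.to (contains⇔ P π)))

Avoids : Pattern → Pattern → Perm → Set
Avoids P Q π = ¬ Occurs P π × ¬ Occurs Q π

avoids⇔ : ∀ P Q π → T (avoidsAllᵇ (word P ∷ word Q ∷ []) π) ⇔ Avoids P Q π
avoids⇔ P Q π = mk⇔ to from
  where
  to : T (avoidsAllᵇ (word P ∷ word Q ∷ []) π) → Avoids P Q π
  to h with all⁺ _ (word P ∷ word Q ∷ []) h
  ... | ¬P ∷ ¬Q ∷ [] = Equivalence.to (¬contains⇔ P π) ¬P , Equivalence.to (¬contains⇔ Q π) ¬Q
  from : Avoids P Q π → T (avoidsAllᵇ (word P ∷ word Q ∷ []) π)
  from (¬P , ¬Q) = all⁻ (λ σ → not (containsᵇ σ π)) {xs = word P ∷ word Q ∷ []}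
    (Equivalence.from (¬contains⇔ P π) ¬P ∷ Equivalence.from (¬contains⇔ Q π) ¬Q ∷ [])

-- Permutations of [n]

∈-words⁻ : ∀ as k {w} → w ∈ words as k → length w ≡ k × All (_∈ as) w
∈-words⁻ as zero (here refl) = refl , []
∈-words⁻ as (suc k) w∈ with find (∈-concatMap⁻ (λ a → map (a ∷_) (words as k)) {xs = as} w∈)
... | a , a∈as , w∈′ with ∈-map⁻ (a ∷_) w∈′
...   | w′ , w′∈ , refl = let len , all = ∈-words⁻ as k w′∈ in cong suc len , a∈as ∷ all

∈-words⁺ : ∀ as {w} → All (_∈ as) w → w ∈ words as (length w)
∈-words⁺ as [] = here refl
∈-words⁺ as {a ∷ w} (a∈as ∷ all) =
  ∈-concatMap⁺ (λ b → map (b ∷_) (words as (length w))) (lose a∈as (∈-map⁺ (a ∷_) (∈-words⁺ as all)))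

words-unique : ∀ {as} k → Unique as → Unique (words as k)
words-unique zero _ = [] ∷ []
words-unique {as} (suc k) u = prefix-unique u
  where
  W = words as k
  prefix-unique : ∀ {bs} → Unique bs → Unique (concatMap (λ b → map (b ∷_) W) bs)
  prefix-unique [] = []
  prefix-unique {b ∷ bs} (b∉bs ∷ ubs) =
    Unique.++⁺ (Unique.map⁺ ∷-injectiveʳ (words-unique k u)) (prefix-unique ubs) disjoint
    where
    disjoint : Disjoint (map (b ∷_) W) (concatMap (λ c → map (c ∷_) W) bs)
    disjoint (v∈ , v∈′) with ∈-map⁻ (b ∷_) v∈ | find (∈-concatMap⁻ (λ c → map (c ∷_) W) {xs = bs} v∈′)
    ... | _ , _ , refl | c , c∈bs , v∈″ with ∈-map⁻ (c ∷_) v∈″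
    ...   | _ , _ , refl = All¬⇒¬Any b∉bs c∈bs

IsPerm : ℕ → Perm → Set
IsPerm n π = π ↭ oneTo n

oneTo-suc : ∀ n → oneTo (suc n) ≡ oneTo n ++ [ suc n ]
oneTo-suc n = trans (cong (map suc) (sym (applyUpTo-∷ʳ id n))) (map-++ suc (upTo n) [ n ])

∈-oneTo⁻ : ∀ {n x} → x ∈ oneTo n → x ≤ n
∈-oneTo⁻ x∈ with ∈-map⁻ suc x∈
... | _ , y∈ , refl = ∈-upTo⁻ y∈

oneTo-unique : ∀ n → Unique (oneTo n)
oneTo-unique n = Unique.map⁺ suc-injective (Unique.upTo⁺ n)

length-oneTo : ∀ n → length (oneTo n) ≡ n
length-oneTo n = trans (length-map suc (upTo n)) (length-upTo n)

module _ {n π} (p : IsPerm n π) where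

  perm-≤ : ∀ {x} → x ∈ π → x ≤ n
  perm-≤ x∈ = ∈-oneTo⁻ (∈-resp-↭ p x∈)

  perm-unique : Unique π
  perm-unique = Unique-resp-↭ (↭⇒↭ₛ (↭-sym p)) (oneTo-unique n)

  suc∉perm : suc n ∉ π
  suc∉perm x∈ = n≮n n (perm-≤ x∈)

perm-max : ∀ {n π} → IsPerm (suc n) π → suc n ∈ π
perm-max {n} p = ∈-resp-↭ (↭-sym p) (subst (suc n ∈_) (sym (oneTo-suc n)) (∈-++⁺ʳ (oneTo n) (here refl)))

perm-insert : ∀ {n} L R → IsPerm n (L ++ R) → IsPerm (suc n) (L ++ suc n ∷ R)
perm-insert {n} L R p = begin
  L ++ suc n ∷ R        ↭⟨ shift (suc n) L R ⟩
  suc n ∷ L ++ R        ↭⟨ prep (suc n) p ⟩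
  [ suc n ] ++ oneTo n  ↭⟨ ++-comm [ suc n ] (oneTo n) ⟩
  oneTo n ++ [ suc n ]  ≡⟨ oneTo-suc n ⟨
  oneTo (suc n)         ∎
  where open PermutationReasoning

perm-delete : ∀ {n} L R → IsPerm (suc n) (L ++ suc n ∷ R) → IsPerm n (L ++ R)
perm-delete {n} L R p =
  subst (L ++ R ↭_) (++-identityʳ (oneTo n)) (drop-mid L (oneTo n) (subst (L ++ suc n ∷ R ↭_) (oneTo-suc n) p))

∈-remove : ∀ (L : List ℕ) {R x y} → y ∈ L ++ x ∷ R → y ≢ x → y ∈ L ++ R
∈-remove L y∈ y≢x with ∈-++⁻ L y∈
... | inj₁ y∈L = ∈-++⁺ˡ y∈L
... | inj₂ (here y≡x) = ⊥-elim (y≢x y≡x)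
... | inj₂ (there y∈R) = ∈-++⁺ʳ L y∈R

unique-⊆-length⇒↭ : ∀ {xs ys : List ℕ} → Unique xs → All (_∈ ys) xs → length ys ≤ length xs → xs ↭ ys
unique-⊆-length⇒↭ {ys = []} [] [] _ = ↭-refl
unique-⊆-length⇒↭ {ys = _ ∷ _} [] [] ()
unique-⊆-length⇒↭ {x ∷ xs} (x∉xs ∷ u) (x∈ys ∷ xs⊆ys) len with ∈-∃++ x∈ys
... | ys₁ , ys₂ , refl = begin
  x ∷ xs          ↭⟨ prep x (unique-⊆-length⇒↭ u xs⊆ys₁++ys₂ len′) ⟩
  x ∷ ys₁ ++ ys₂  ↭⟨ shift x ys₁ ys₂ ⟨
  ys₁ ++ x ∷ ys₂  ∎
  where
  open PermutationReasoning
  xs⊆ys₁++ys₂ : All (_∈ ys₁ ++ ys₂) xs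
  xs⊆ys₁++ys₂ = All.zipWith (λ (x≢z , z∈) → ∈-remove ys₁ z∈ (x≢z ∘ sym)) (x∉xs , xs⊆ys)
  len′ : length (ys₁ ++ ys₂) ≤ length xs
  len′ = ≤-pred (subst (_≤ suc (length xs)) (length-++-sucʳ ys₁ x ys₂) len)

∈-S⁻ : ∀ {n π} → π ∈ S n → IsPerm n π
∈-S⁻ {n} {π} π∈ with ∈-filter⁻ (λ w → distinctᵇ w ≟ᵇ true) {xs = words (oneTo n) n} π∈
... | π∈words , distinct with ∈-words⁻ (oneTo n) n π∈words
...   | len , π⊆ = unique-⊆-length⇒↭ (Equivalence.to T-distinctᵇ (Equivalence.from T-≡ distinct)) π⊆
                     (≤-reflexive (trans (length-oneTo n) (sym len)))

∈-S⁺ : ∀ {n π} → IsPerm n π → π ∈ S n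
∈-S⁺ {n} {π} p = ∈-filter⁺ (λ w → distinctᵇ w ≟ᵇ true) π∈words
  (Equivalence.to T-≡ (Equivalence.from T-distinctᵇ (perm-unique p)))
  where
  π∈words : π ∈ words (oneTo n) n
  π∈words = subst (λ k → π ∈ words (oneTo n) k) (trans (↭-length p) (length-oneTo n))
              (∈-words⁺ (oneTo n) (All.tabulate (∈-resp-↭ p)))

S-unique : ∀ n → Unique (S n)
S-unique n = Unique.filter⁺ (λ w → distinctᵇ w ≟ᵇ true) (words-unique n (oneTo-unique n))

disjoint-++ : ∀ (L : List ℕ) {R x} → Unique (L ++ R) → x ∈ L → x ∉ R
disjoint-++ (y ∷ L) (y∉ ∷ _) (here refl) x∈R = All¬⇒¬Any y∉ (∈-++⁺ʳ L x∈R)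
disjoint-++ (y ∷ L) (_ ∷ u) (there x∈L) = disjoint-++ L u x∈L

unique-++ʳ : ∀ (L : List ℕ) {R} → Unique (L ++ R) → Unique R
unique-++ʳ [] u = u
unique-++ʳ (_ ∷ L) (_ ∷ u) = unique-++ʳ L u

module _ {N L R} (p : IsPerm N (L ++ N ∷ R)) where

  ∉-left : N ∉ L
  ∉-left N∈L = disjoint-++ L (perm-unique p) N∈L (here refl)

  ∉-right : N ∉ R
  ∉-right = Unique.Unique[x∷xs]⇒x∉xs (unique-++ʳ L (perm-unique p))

  below-left : ∀ {x} → x ∈ L → x < N
  below-left x∈L = ≤∧≢⇒< (perm-≤ p (∈-++⁺ˡ x∈L)) (λ { refl → ∉-left x∈L })

  below-right : ∀ {x} → x ∈ R → x < N
  below-right x∈R = ≤∧≢⇒< (perm-≤ p (∈-++⁺ʳ L (there x∈R))) (λ { refl → ∉-right x∈R })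

below-new : ∀ {N τ x} → IsPerm N τ → x ∈ τ → x < suc N
below-new p x∈ = s≤s (perm-≤ p x∈)

below-max : ∀ {N τ x} → IsPerm N τ → x ∈ τ → x ≢ N → x < N
below-max p x∈ = ≤∧≢⇒< (perm-≤ p x∈)

-- Charge under insertion of the maximum

bit : Bool → ℕ
bit b = if b then 1 else 0

beforePred : Perm → ℕ → Bool
beforePred π i = pos i π <ᵇ pos (pred i) π

-- idesAt π i = 1 exactly when chv i ≠ 0, so ides π is the number of descents of π⁻¹.
idesAt : Perm → ℕ → ℕ
idesAt π zero = 0
idesAt π (suc zero) = 0
idesAt π (suc (suc j)) = bit (beforePred π (suc (suc j)))

ides : Perm → ℕ
ides π = sum (map (idesAt π) (oneTo (length π)))

pos-insert : ∀ L R M {x y} → x ≢ M → y ≢ M →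
  (pos x (L ++ M ∷ R) <ᵇ pos y (L ++ M ∷ R)) ≡ (pos x (L ++ R) <ᵇ pos y (L ++ R))
pos-insert [] R M x≢M y≢M rewrite ≡ᵇ-false x≢M | ≡ᵇ-false y≢M = refl
pos-insert (z ∷ L) R M {x} {y} x≢M y≢M with x ≡ᵇ z | y ≡ᵇ z
... | true  | true  = refl
... | true  | false = refl
... | false | true  = refl
... | false | false = pos-insert L R M x≢M y≢M

beforePred-insert : ∀ L R N {j} → suc (suc j) ≤ N →
  beforePred (L ++ suc N ∷ R) (suc (suc j)) ≡ beforePred (L ++ R) (suc (suc j))
beforePred-insert L R N j<N = pos-insert L R (suc N) (<⇒≢ (s≤s j<N)) (<⇒≢ (s≤s (≤-trans (n≤1+n _) j<N)))

chv-insert : ∀ L R N i → i ≤ N → chv (suc N) (L ++ suc N ∷ R) i ≡ idesAt (L ++ R) i + chv N (L ++ R) i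
chv-insert L R N zero _ = refl
chv-insert L R N (suc zero) _ = refl
chv-insert L R N (suc (suc j)) i≤N rewrite beforePred-insert L R N i≤N with beforePred (L ++ R) (suc (suc j))
... | true  = +-∸-assoc 1 (m≤n⇒m≤1+n i≤N)
... | false = refl

idesAt-insert : ∀ L R N i → i ≤ N → idesAt (L ++ suc N ∷ R) i ≡ idesAt (L ++ R) i
idesAt-insert L R N zero _ = refl
idesAt-insert L R N (suc zero) _ = refl
idesAt-insert L R N (suc (suc j)) i≤N = cong bit (beforePred-insert L R N i≤N)

chv-max : ∀ π n → chv (suc (suc n)) π (suc (suc n)) ≡ bit (beforePred π (suc (suc n)))
chv-max π n with beforePred π (suc (suc n))
... | true  = m+n∸n≡m 1 (suc (suc n))
... | false = refl

sum-map-+ : ∀ (f g : ℕ → ℕ) xs → sum (map (λ x → f x + g x) xs) ≡ sum (map f xs) + sum (map g xs)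
sum-map-+ f g [] = refl
sum-map-+ f g (x ∷ xs) = trans (cong (f x + g x +_) (sum-map-+ f g xs)) (+-interchange (f x) (g x) _ _)

sum-oneTo-suc : ∀ (f : ℕ → ℕ) n → sum (map f (oneTo (suc n))) ≡ sum (map f (oneTo n)) + f (suc n)
sum-oneTo-suc f n = begin
  sum (map f (oneTo (suc n)))                  ≡⟨ cong (sum ∘ map f) (oneTo-suc n) ⟩
  sum (map f (oneTo n ++ [ suc n ]))           ≡⟨ cong sum (map-++ f (oneTo n) [ suc n ]) ⟩
  sum (map f (oneTo n) ++ [ f (suc n) ])       ≡⟨ sum-++ (map f (oneTo n)) [ f (suc n) ] ⟩
  sum (map f (oneTo n)) + (f (suc n) + 0)      ≡⟨ cong (sum (map f (oneTo n)) +_) (+-identityʳ (f (suc n))) ⟩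
  sum (map f (oneTo n)) + f (suc n)            ∎
  where open ≡-Reasoning

sum-oneTo-cong : ∀ {f g : ℕ → ℕ} n → (∀ i → i ≤ n → f i ≡ g i) → sum (map f (oneTo n)) ≡ sum (map g (oneTo n))
sum-oneTo-cong n f≗g = cong sum (map-cong-local (All.tabulate (λ {i} i∈ → f≗g i (∈-oneTo⁻ i∈))))

module _ {n} (L R : Perm) (len : length (L ++ R) ≡ suc n) where
  open ≡-Reasoning

  private
    N M : ℕ
    N = suc n
    M = suc N
    b : Bool
    b = beforePred (L ++ M ∷ R) M

    length-inserted : length (L ++ M ∷ R) ≡ M
    length-inserted = trans (length-++-sucʳ L M R) (cong suc len)

  ch-insert-max : ch (L ++ M ∷ R) ≡ ides (L ++ R) + ch (L ++ R) + bit b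
  ch-insert-max = begin
    ch (L ++ M ∷ R)
      ≡⟨ cong (λ m → sum (map (chv m (L ++ M ∷ R)) (oneTo m))) length-inserted ⟩
    sum (map (chv M (L ++ M ∷ R)) (oneTo M))
      ≡⟨ sum-oneTo-suc (chv M (L ++ M ∷ R)) N ⟩
    sum (map (chv M (L ++ M ∷ R)) (oneTo N)) + chv M (L ++ M ∷ R) M
      ≡⟨ cong₂ _+_ (sum-oneTo-cong N (chv-insert L R N)) (chv-max (L ++ M ∷ R) n) ⟩
    sum (map (λ i → idesAt (L ++ R) i + chv N (L ++ R) i) (oneTo N)) + bit b
      ≡⟨ cong (_+ bit b) (sum-map-+ (idesAt (L ++ R)) (chv N (L ++ R)) (oneTo N)) ⟩
    sum (map (idesAt (L ++ R)) (oneTo N)) + sum (map (chv N (L ++ R)) (oneTo N)) + bit b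
      ≡⟨ cong (λ m → sum (map (idesAt (L ++ R)) (oneTo m)) + sum (map (chv m (L ++ R)) (oneTo m)) + bit b) len ⟨
    ides (L ++ R) + ch (L ++ R) + bit b
      ∎

  ides-insert-max : ides (L ++ M ∷ R) ≡ ides (L ++ R) + bit b
  ides-insert-max = begin
    ides (L ++ M ∷ R)
      ≡⟨ cong (λ m → sum (map (idesAt (L ++ M ∷ R)) (oneTo m))) length-inserted ⟩
    sum (map (idesAt (L ++ M ∷ R)) (oneTo M))
      ≡⟨ sum-oneTo-suc (idesAt (L ++ M ∷ R)) N ⟩
    sum (map (idesAt (L ++ M ∷ R)) (oneTo N)) + bit b
      ≡⟨ cong (_+ bit b) (sum-oneTo-cong N (idesAt-insert L R N)) ⟩
    sum (map (idesAt (L ++ R)) (oneTo N)) + bit b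
      ≡⟨ cong (λ m → sum (map (idesAt (L ++ R)) (oneTo m)) + bit b) len ⟨
    ides (L ++ R) + bit b
      ∎

-- Generating avoiders by inserting the maximum

data InsertsMax (n : ℕ) : Perm → Perm → Bool → Set where
  inserts : ∀ L R → InsertsMax n (L ++ R) (L ++ suc (suc n) ∷ R)
                                 (beforePred (L ++ suc (suc n) ∷ R) (suc (suc n)))

chStat : Perm → ℕ × ℕ
chStat π = ch π , ides π

grow : Bool → ℕ × ℕ → ℕ × ℕ
grow b (c , d) = d + c + bit b , d + bit b

chStat-insert : ∀ {n τ π b} → IsPerm (suc n) τ → InsertsMax n τ π b → chStat π ≡ grow b (chStat τ)
chStat-insert {n} p (inserts L R) = cong₂ _,_ (ch-insert-max L R len) (ides-insert-max L R len)
  where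
  len : length (L ++ R) ≡ suc n
  len = trans (↭-length p) (length-oneTo (suc n))

chStats : ℕ → List (ℕ × ℕ)
chStats zero = [ 0 , 0 ]
chStats (suc zero) = [ 0 , 0 ]
chStats (suc (suc n)) = map (grow true) (chStats (suc n)) ++ map (grow false) (chStats (suc n))

record MaxInsertionScheme (𝒜 : Perm → Set) : Set where
  field
    left right    : ℕ → Perm → Perm
    𝒜-[]          : 𝒜 []
    𝒜-[1]         : 𝒜 [ 1 ]
    𝒜-delete      : ∀ L R {m} → 𝒜 (L ++ m ∷ R) → 𝒜 (L ++ R)
    left-inserts  : ∀ {n τ} → IsPerm (suc n) τ → InsertsMax n τ (left (suc (suc n)) τ) true
    right-inserts : ∀ {n τ} → IsPerm (suc n) τ → InsertsMax n τ (right (suc (suc n)) τ) false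
    left-𝒜        : ∀ {n τ} → IsPerm (suc n) τ → 𝒜 τ → 𝒜 (left (suc (suc n)) τ)
    right-𝒜       : ∀ {n τ} → IsPerm (suc n) τ → 𝒜 τ → 𝒜 (right (suc (suc n)) τ)
    left-or-right : ∀ {n} L R → IsPerm (suc (suc n)) (L ++ suc (suc n) ∷ R) → 𝒜 (L ++ suc (suc n) ∷ R) →
                    L ++ suc (suc n) ∷ R ≡ left (suc (suc n)) (L ++ R) ⊎
                    L ++ suc (suc n) ∷ R ≡ right (suc (suc n)) (L ++ R)

∷-cancel : ∀ {x : ℕ} L L′ {R R′} → x ∉ L → x ∉ L′ → L ++ x ∷ R ≡ L′ ++ x ∷ R′ → L ++ R ≡ L′ ++ R′
∷-cancel [] [] _ _ refl = refl
∷-cancel [] (y ∷ L′) _ x∉L′ refl = ⊥-elim (x∉L′ (here refl))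
∷-cancel (y ∷ L) [] x∉L _ refl = ⊥-elim (x∉L (here refl))
∷-cancel (y ∷ L) (y′ ∷ L′) x∉L x∉L′ eq =
  cong₂ _∷_ (∷-injectiveˡ eq) (∷-cancel L L′ (x∉L ∘ there) (x∉L′ ∘ there) (∷-injectiveʳ eq))

insertsMax-perm : ∀ {n τ π b} → IsPerm (suc n) τ → InsertsMax n τ π b → IsPerm (suc (suc n)) π
insertsMax-perm p (inserts L R) = perm-insert L R p

insertsMax-injective : ∀ {n τ τ′ π π′ b b′} → IsPerm (suc n) τ → IsPerm (suc n) τ′ →
  InsertsMax n τ π b → InsertsMax n τ′ π′ b′ → π ≡ π′ → τ ≡ τ′ × b ≡ b′
insertsMax-injective {n} p p′ (inserts L R) (inserts L′ R′) eq =
  ∷-cancel L L′ (suc∉perm p ∘ ∈-++⁺ˡ) (suc∉perm p′ ∘ ∈-++⁺ˡ) eq ,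
  cong (λ π → beforePred π (suc (suc n))) eq

unique-map⁺ : ∀ {A B : Set} {f : A → B} {xs} → (∀ {x y} → x ∈ xs → y ∈ xs → f x ≡ f y → x ≡ y) →
              Unique xs → Unique (map f xs)
unique-map⁺ {xs = []} _ [] = []
unique-map⁺ {xs = x ∷ xs} inj (x∉xs ∷ u) =
  All-map⁺ (All.tabulate (λ y∈ fx≡fy → All.lookup x∉xs y∈ (inj (here refl) (there y∈) fx≡fy))) ∷
  unique-map⁺ (λ x∈ y∈ → inj (there x∈) (there y∈)) u

module Generation {𝒜 : Perm → Set} (scheme : MaxInsertionScheme 𝒜) where
  open MaxInsertionScheme scheme

  gen : ℕ → List Perm
  gen zero = [ [] ]
  gen (suc zero) = [ [ 1 ] ]
  gen (suc (suc n)) = map (left (suc (suc n))) (gen (suc n)) ++ map (right (suc (suc n))) (gen (suc n))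

  module _ (n : ℕ) where
    private
      M : ℕ
      M = suc (suc n)
      G : List Perm
      G = gen (suc n)

    gen-sound-step : (∀ {τ} → τ ∈ G → IsPerm (suc n) τ × 𝒜 τ) → ∀ {π} → π ∈ gen M → IsPerm M π × 𝒜 π
    gen-sound-step ih π∈ with ∈-++⁻ (map (left M) G) π∈
    ... | inj₁ π∈ˡ with τ , τ∈ , refl ← ∈-map⁻ (left M) π∈ˡ =
      let p , a = ih τ∈ in insertsMax-perm p (left-inserts p) , left-𝒜 p a
    ... | inj₂ π∈ʳ with τ , τ∈ , refl ← ∈-map⁻ (right M) π∈ʳ =
      let p , a = ih τ∈ in insertsMax-perm p (right-inserts p) , right-𝒜 p a

    gen-complete-step : (∀ {τ} → IsPerm (suc n) τ → 𝒜 τ → τ ∈ G) → ∀ {π} → IsPerm M π → 𝒜 π → π ∈ gen M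
    gen-complete-step ih p a with L , R , refl ← ∈-∃++ (perm-max p)
      with τ∈ ← ih (perm-delete L R p) (𝒜-delete L R a) | left-or-right L R p a
    ... | inj₁ eq = ∈-++⁺ˡ (subst (_∈ map (left M) G) (sym eq) (∈-map⁺ (left M) τ∈))
    ... | inj₂ eq = ∈-++⁺ʳ (map (left M) G) (subst (_∈ map (right M) G) (sym eq) (∈-map⁺ (right M) τ∈))

  gen-sound : ∀ n {π} → π ∈ gen n → IsPerm n π × 𝒜 π
  gen-sound zero (here refl) = ↭-refl , 𝒜-[]
  gen-sound (suc zero) (here refl) = ↭-refl , 𝒜-[1]
  gen-sound (suc (suc n)) = gen-sound-step n (gen-sound (suc n))

  gen-complete : ∀ n {π} → IsPerm n π → 𝒜 π → π ∈ gen n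
  gen-complete zero p _ with refl ← ↭-empty-inv p = here refl
  gen-complete (suc zero) p _ with refl ← ↭-singleton-inv p = here refl
  gen-complete (suc (suc n)) = gen-complete-step n (gen-complete (suc n))

  module _ (n : ℕ) where
    private
      M : ℕ
      M = suc (suc n)
      G : List Perm
      G = gen (suc n)

      perm : ∀ {τ} → τ ∈ G → IsPerm (suc n) τ
      perm = proj₁ ∘ gen-sound (suc n)

      injective : ∀ {f : Perm → Perm} {b} → (∀ {τ} → IsPerm (suc n) τ → InsertsMax n τ (f τ) b) →
                  ∀ {τ τ′} → τ ∈ G → τ′ ∈ G → f τ ≡ f τ′ → τ ≡ τ′
      injective ins τ∈ τ′∈ eq =
        proj₁ (insertsMax-injective (perm τ∈) (perm τ′∈) (ins (perm τ∈)) (ins (perm τ′∈)) eq)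

      disjoint : Disjoint (map (left M) G) (map (right M) G)
      disjoint (π∈ˡ , π∈ʳ) with τ , τ∈ , refl ← ∈-map⁻ (left M) π∈ˡ | τ′ , τ′∈ , eq ← ∈-map⁻ (right M) π∈ʳ
        with () ← proj₂ (insertsMax-injective (perm τ∈) (perm τ′∈)
                                              (left-inserts (perm τ∈)) (right-inserts (perm τ′∈)) eq)

      grows : ∀ {f : Perm → Perm} {b} → (∀ {τ} → IsPerm (suc n) τ → InsertsMax n τ (f τ) b) →
              map chStat (map f G) ≡ map (grow b) (map chStat G)
      grows {f} {b} ins = begin
        map chStat (map f G)         ≡⟨ map-∘ G ⟨
        map (chStat ∘ f) G           ≡⟨ map-cong-local (All.tabulate (λ τ∈ → chStat-insert (perm τ∈) (ins (perm τ∈))))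
                                      ⟩
        map (grow b ∘ chStat) G      ≡⟨ map-∘ G ⟩
        map (grow b) (map chStat G)  ∎
        where open ≡-Reasoning

    gen-unique-step : Unique G → Unique (gen M)
    gen-unique-step u = Unique.++⁺ (unique-map⁺ (injective {left M} left-inserts) u)
                                    (unique-map⁺ (injective {right M} right-inserts) u) disjoint

    gen-chStats-step : map chStat G ≡ chStats (suc n) → map chStat (gen M) ≡ chStats M
    gen-chStats-step ih = begin
      map chStat (map (left M) G ++ map (right M) G)
        ≡⟨ map-++ chStat (map (left M) G) (map (right M) G) ⟩
      map chStat (map (left M) G) ++ map chStat (map (right M) G)
        ≡⟨ cong₂ _++_ (grows {left M} left-inserts) (grows {right M} right-inserts) ⟩
      map (grow true) (map chStat G) ++ map (grow false) (map chStat G)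
        ≡⟨ cong (λ stats → map (grow true) stats ++ map (grow false) stats) ih ⟩
      chStats M
        ∎
      where open ≡-Reasoning

  gen-unique : ∀ n → Unique (gen n)
  gen-unique zero = [] ∷ []
  gen-unique (suc zero) = [] ∷ []
  gen-unique (suc (suc n)) = gen-unique-step n (gen-unique (suc n))

  gen-chStats : ∀ n → map chStat (gen n) ≡ chStats n
  gen-chStats zero = refl
  gen-chStats (suc zero) = refl
  gen-chStats (suc (suc n)) = gen-chStats-step n (gen-chStats (suc n))

chCount : ℕ → ℕ → ℕ
chCount n k = length (filter (λ s → (proj₁ s ≡ᵇ k) ≟ᵇ true) (chStats n))

length-filter-map : ∀ {A B : Set} (f : A → B) (p : B → Bool) xs →
  length (filter (λ x → p (f x) ≟ᵇ true) xs) ≡ length (filter (λ y → p y ≟ᵇ true) (map f xs))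
length-filter-map f p [] = refl
length-filter-map f p (x ∷ xs) with p (f x)
... | true  = cong suc (length-filter-map f p xs)
... | false = length-filter-map f p xs

ChCoeff≡chCount : ∀ {𝒜} → MaxInsertionScheme 𝒜 → ∀ Π → (∀ σ → T (avoidsAllᵇ Π σ) ⇔ 𝒜 σ) →
                  ∀ n k → ChCoeff n Π k ≡ chCount n k
ChCoeff≡chCount scheme Π avoids⇔𝒜 n k = begin
  length (filter P? (S n))                 ≡⟨ ↭-length (∼bag⇒↭ (unique∧set⇒bag unique-P unique-Q same)) ⟩
  length (filter Q? (gen n))               ≡⟨ length-filter-map chStat (λ s → proj₁ s ≡ᵇ k) (gen n) ⟩
  length (filter R? (map chStat (gen n)))  ≡⟨ cong (length ∘ filter R?) (gen-chStats n) ⟩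
  chCount n k                              ∎
  where
  open ≡-Reasoning
  open Generation scheme
  P? = λ σ → (avoidsAllᵇ Π σ ∧ (ch σ ≡ᵇ k)) ≟ᵇ true
  Q? = λ σ → (ch σ ≡ᵇ k) ≟ᵇ true
  R? = λ (s : ℕ × ℕ) → (proj₁ s ≡ᵇ k) ≟ᵇ true
  unique-P = Unique.filter⁺ P? (S-unique n)
  unique-Q = Unique.filter⁺ Q? (gen-unique n)
  same : ∀ {σ} → σ ∈ filter P? (S n) ⇔ σ ∈ filter Q? (gen n)
  same {σ} = mk⇔ to from
    where
    to : σ ∈ filter P? (S n) → σ ∈ filter Q? (gen n)
    to σ∈ with σ∈S , h ← ∈-filter⁻ P? {xs = S n} σ∈
      with avoids , ch≡k ← Equivalence.to (T-∧ {avoidsAllᵇ Π σ}) (Equivalence.from T-≡ h) =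
      ∈-filter⁺ Q? (gen-complete n (∈-S⁻ σ∈S) (Equivalence.to (avoids⇔𝒜 σ) avoids)) (Equivalence.to T-≡ ch≡k)
    from : σ ∈ filter Q? (gen n) → σ ∈ filter P? (S n)
    from σ∈ with σ∈gen , h ← ∈-filter⁻ Q? {xs = gen n} σ∈ with p , a ← gen-sound n σ∈gen =
      ∈-filter⁺ P? (∈-S⁺ p)
        (Equivalence.to T-≡ (Equivalence.from T-∧ (Equivalence.from (avoids⇔𝒜 σ) a , Equivalence.from T-≡ h)))

-- Four ways of inserting the maximum

pos-++-∉ : ∀ L {x ys} → x ∉ L → pos x (L ++ ys) ≡ length L + pos x ys
pos-++-∉ [] _ = refl
pos-++-∉ (y ∷ L) {x} x∉ rewrite ≡ᵇ-false {x} {y} (x∉ ∘ here) = cong suc (pos-++-∉ L (x∉ ∘ there))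

pos-++-∈ : ∀ L {x ys} → x ∈ L → pos x (L ++ ys) < length L
pos-++-∈ (y ∷ L) {x} (here refl) rewrite ≡ᵇ-refl x = s≤s z≤n
pos-++-∈ (y ∷ L) {x} (there x∈L) with x ≡ᵇ y
... | true  = s≤s z≤n
... | false = s≤s (pos-++-∈ L x∈L)

beforePred-left : ∀ L R N → N ∉ L → suc N ∉ L → beforePred (L ++ suc N ∷ R) (suc N) ≡ true
beforePred-left L R N N∉L M∉L
  rewrite pos-++-∉ L {ys = suc N ∷ R} M∉L | pos-++-∉ L {ys = suc N ∷ R} N∉L
        | ≡ᵇ-refl N | ≡ᵇ-false (<⇒≢ (n<1+n N))
  = <ᵇ-true (+-monoʳ-< (length L) z<s)

beforePred-right : ∀ L R N → N ∈ L → suc N ∉ L → beforePred (L ++ suc N ∷ R) (suc N) ≡ false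
beforePred-right L R N N∈L M∉L rewrite pos-++-∉ L {ys = suc N ∷ R} M∉L | ≡ᵇ-refl N =
  <ᵇ-false (≤-trans (<⇒≤ (pos-++-∈ L N∈L)) (≤-reflexive (sym (+-identityʳ (length L)))))

insertsMax : ∀ {n τ π b} L R → L ++ R ≡ τ → L ++ suc (suc n) ∷ R ≡ π →
             beforePred (L ++ suc (suc n) ∷ R) (suc (suc n)) ≡ b → InsertsMax n τ π b
insertsMax L R refl refl refl = inserts L R

front back : ℕ → Perm → Perm
front M τ = M ∷ τ
back M τ = τ ++ [ M ]

-- Both place M next to M − 1; the clauses for [] are only reached when M − 1 is absent.
insertBefore insertAfter : ℕ → Perm → Perm
insertBefore M [] = [ M ]
insertBefore M (x ∷ τ) = if x ≡ᵇ pred M then M ∷ x ∷ τ else x ∷ insertBefore M τ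
insertAfter M [] = [ M ]
insertAfter M (x ∷ τ) = if x ≡ᵇ pred M then x ∷ M ∷ τ else x ∷ insertAfter M τ

insertBefore-≡ : ∀ L R N → N ∉ L → insertBefore (suc N) (L ++ N ∷ R) ≡ L ++ suc N ∷ N ∷ R
insertBefore-≡ [] R N _ rewrite ≡ᵇ-refl N = refl
insertBefore-≡ (x ∷ L) R N N∉ rewrite ≡ᵇ-false {x} {N} (N∉ ∘ here ∘ sym) =
  cong (x ∷_) (insertBefore-≡ L R N (N∉ ∘ there))

insertAfter-≡ : ∀ L R N → N ∉ L → insertAfter (suc N) (L ++ N ∷ R) ≡ L ++ N ∷ suc N ∷ R
insertAfter-≡ [] R N _ rewrite ≡ᵇ-refl N = refl
insertAfter-≡ (x ∷ L) R N N∉ rewrite ≡ᵇ-false {x} {N} (N∉ ∘ here ∘ sym) =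
  cong (x ∷_) (insertAfter-≡ L R N (N∉ ∘ there))

module _ {n τ} (p : IsPerm (suc n) τ) where
  private
    N M : ℕ
    N = suc n
    M = suc N

  front-inserts : InsertsMax n τ (front M τ) true
  front-inserts = insertsMax [] τ refl refl (beforePred-left [] τ N (λ ()) (λ ()))

  back-inserts : InsertsMax n τ (back M τ) false
  back-inserts = insertsMax τ [] (++-identityʳ τ) refl (beforePred-right τ [] N (perm-max p) (suc∉perm p))

  insertBefore-inserts : InsertsMax n τ (insertBefore M τ) true
  insertBefore-inserts with L , R , refl ← ∈-∃++ (perm-max p) =
    insertsMax L (N ∷ R) refl (sym (insertBefore-≡ L R N (∉-left p)))
      (beforePred-left L (N ∷ R) N (∉-left p) (suc∉perm p ∘ ∈-++⁺ˡ))

  insertAfter-inserts : InsertsMax n τ (insertAfter M τ) false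
  insertAfter-inserts with L , R , refl ← ∈-∃++ (perm-max p) =
    insertsMax (L ++ [ N ]) R (++-assoc L [ N ] R)
      (trans (++-assoc L [ N ] (M ∷ R)) (sym (insertAfter-≡ L R N (∉-left p))))
      (beforePred-right (L ++ [ N ]) R N (∈-++⁺ʳ L (here refl)) M∉)
    where
    M∉ : M ∉ L ++ [ N ]
    M∉ M∈ with ∈-++⁻ L M∈
    ... | inj₁ M∈L = suc∉perm p (∈-++⁺ˡ M∈L)
    ... | inj₂ (here M≡N) = <-irrefl (sym M≡N) (n<1+n N)

-- Avoidance under these insertions

⊆-split : ∀ {s} L R (m : ℕ) → s ⊆ L ++ m ∷ R →
  s ⊆ L ++ R ⊎ ∃₂ λ (s₁ s₂ : List ℕ) → s ≡ s₁ ++ m ∷ s₂ × s₁ ⊆ L × s₂ ⊆ R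
⊆-split [] R m (.m ∷ʳ s⊆R) = inj₁ s⊆R
⊆-split [] R m (refl ∷ s⊆R) = inj₂ ([] , _ , refl , [] , s⊆R)
⊆-split (y ∷ L) R m (.y ∷ʳ s⊆) with ⊆-split L R m s⊆
... | inj₁ s⊆L++R = inj₁ (y ∷ʳ s⊆L++R)
... | inj₂ (s₁ , s₂ , eq , s₁⊆L , s₂⊆R) = inj₂ (s₁ , s₂ , eq , y ∷ʳ s₁⊆L , s₂⊆R)
⊆-split (y ∷ L) R m (refl ∷ s⊆) with ⊆-split L R m s⊆
... | inj₁ s⊆L++R = inj₁ (refl ∷ s⊆L++R)
... | inj₂ (s₁ , s₂ , refl , s₁⊆L , s₂⊆R) = inj₂ (y ∷ s₁ , s₂ , refl , refl ∷ s₁⊆L , s₂⊆R)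

data Through (L R : Perm) (m a b c : ℕ) : Set where
  avoiding : a ∷ b ∷ c ∷ [] ⊆ L ++ R → Through L R m a b c
  first    : a ≡ m → b ∷ c ∷ [] ⊆ R → Through L R m a b c
  second   : a ∈ L → b ≡ m → c ∈ R → Through L R m a b c
  third    : a ∷ b ∷ [] ⊆ L → c ≡ m → Through L R m a b c

through : ∀ L R m {a b c} → a ∷ b ∷ c ∷ [] ⊆ L ++ m ∷ R → Through L R m a b c
through L R m s with ⊆-split L R m s
... | inj₁ s′ = avoiding s′
... | inj₂ ([] , _ , refl , _ , s₂) = first refl s₂
... | inj₂ (_ ∷ [] , _ ∷ [] , refl , s₁ , s₂) = second (lookup s₁ (here refl)) refl (lookup s₂ (here refl))
... | inj₂ (_ ∷ _ ∷ [] , [] , refl , s₁ , _) = third s₁ refl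
... | inj₂ (_ ∷ _ ∷ _ ∷ [] , _ , () , _)
... | inj₂ (_ ∷ _ ∷ _ ∷ _ ∷ _ , _ , () , _)

front-avoids : ∀ P → (∀ {a b c} → Shape P a b c → a < b ⊎ a < c) →
               ∀ {N τ} → IsPerm N τ → ¬ Occurs P τ → ¬ Occurs P (front (suc N) τ)
front-avoids P first-not-max {τ = τ} p ¬occ (occurs s shape) with through [] τ _ s
... | avoiding s′ = ¬occ (occurs s′ shape)
... | first refl bc⊆τ with first-not-max shape
...   | inj₁ M<b = <-asym M<b (below-new p (lookup bc⊆τ (here refl)))
...   | inj₂ M<c = <-asym M<c (below-new p (lookup bc⊆τ (there (here refl))))

back-avoids : ∀ P → (∀ {a b c} → Shape P a b c → c < a ⊎ c < b) →
              ∀ {N τ} → IsPerm N τ → ¬ Occurs P τ → ¬ Occurs P (back (suc N) τ)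
back-avoids P last-not-max {τ = τ} p ¬occ (occurs s shape) with through τ [] _ s
... | avoiding s′ = ¬occ (occurs (subst (_ ⊆_) (++-identityʳ τ) s′) shape)
... | third ab⊆τ refl with last-not-max shape
...   | inj₁ M<a = <-asym M<a (below-new p (lookup ab⊆τ (here refl)))
...   | inj₂ M<b = <-asym M<b (below-new p (lookup ab⊆τ (there (here refl))))

PreservedBefore PreservedAfter : Pattern → Set
PreservedBefore P = ∀ {N L R} → IsPerm N (L ++ N ∷ R) →
                    ¬ Occurs P (L ++ N ∷ R) → ¬ Occurs P (L ++ suc N ∷ N ∷ R)
PreservedAfter P = ∀ {N L R} → IsPerm N (L ++ N ∷ R) →
                   ¬ Occurs P (L ++ N ∷ R) → ¬ Occurs P (L ++ N ∷ suc N ∷ R)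

213-preservedBefore : PreservedBefore 213-pattern
213-preservedBefore {N} {L} {R} p ¬occ (occurs s (b<a , a<c)) with through L (N ∷ R) (suc N) s
... | avoiding s′ = ¬occ (occurs s′ (b<a , a<c))
... | first refl bc⊆ = <-asym a<c (below-new p (∈-++⁺ʳ L (lookup bc⊆ (there (here refl)))))
... | second a∈L refl _ = <-asym b<a (below-new p (∈-++⁺ˡ a∈L))
... | third ab⊆L refl =
  ¬occ (occurs (++⁺ ab⊆L (refl ∷ []⊆-universal R)) (b<a , below-left p (lookup ab⊆L (here refl))))

312-preservedBefore : PreservedBefore 312-pattern
312-preservedBefore {N} {L} {R} p ¬occ (occurs s (b<c , c<a)) with through L (N ∷ R) (suc N) s
... | avoiding s′ = ¬occ (occurs s′ (b<c , c<a))
... | first refl (refl ∷ c⊆R) = <-asym b<c (below-right p (lookup c⊆R (here refl)))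
... | first refl (.N ∷ʳ bc⊆R) =
  ¬occ (occurs (++⁺ ([]⊆-universal L) (refl ∷ bc⊆R)) (b<c , below-right p (lookup bc⊆R (there (here refl)))))
... | second _ refl c∈ = <-asym b<c (below-new p (∈-++⁺ʳ L c∈))
... | third ab⊆L refl = <-asym c<a (below-new p (∈-++⁺ˡ (lookup ab⊆L (here refl))))

231-preservedBefore : PreservedBefore 231-pattern
231-preservedBefore {N} {L} {R} p ¬occ (occurs s (c<a , a<b)) with through L (N ∷ R) (suc N) s
... | avoiding s′ = ¬occ (occurs s′ (c<a , a<b))
... | first refl bc⊆ = <-asym a<b (below-new p (∈-++⁺ʳ L (lookup bc⊆ (here refl))))
... | second a∈L refl (here refl) = <-asym c<a (below-left p a∈L)
... | second a∈L refl (there c∈R) =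
  ¬occ (occurs (++⁺ (from∈ a∈L) (refl ∷ from∈ c∈R)) (c<a , below-left p a∈L))
... | third ab⊆L refl = <-asym c<a (below-new p (∈-++⁺ˡ (lookup ab⊆L (here refl))))

module _ {N : ℕ} (L R : Perm) where

  ⊆-reassoc : ∀ {s x} → s ⊆ L ++ N ∷ x ∷ R → s ⊆ (L ++ [ N ]) ++ x ∷ R
  ⊆-reassoc = subst (_ ⊆_) (sym (++-assoc L [ N ] (_ ∷ R)))

  ⊆-unreassoc : ∀ {s} → s ⊆ (L ++ [ N ]) ++ R → s ⊆ L ++ N ∷ R
  ⊆-unreassoc = subst (_ ⊆_) (++-assoc L [ N ] R)

  ∈-unreassoc : ∀ {x} → x ∈ L ++ [ N ] → x ∈ L ++ N ∷ R
  ∈-unreassoc x∈ = subst (_ ∈_) (++-assoc L [ N ] R) (∈-++⁺ˡ x∈)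

pair-⊆-∷ʳ : ∀ {a b N} L → a ∷ b ∷ [] ⊆ L ++ [ N ] → a ∷ b ∷ [] ⊆ L ⊎ (a ∈ L × b ≡ N)
pair-⊆-∷ʳ L ab⊆ with ⊆-split L [] _ ab⊆
... | inj₁ ab⊆L = inj₁ (subst (_ ⊆_) (++-identityʳ L) ab⊆L)
... | inj₂ (_ ∷ [] , [] , refl , a⊆L , []) = inj₂ (lookup a⊆L (here refl) , refl)
... | inj₂ ([] , _ , refl , _ , ())
... | inj₂ (_ ∷ _ ∷ [] , _ , () , _)
... | inj₂ (_ ∷ _ ∷ _ ∷ _ , _ , () , _)

213-preservedAfter : PreservedAfter 213-pattern
213-preservedAfter {N} {L} {R} p ¬occ (occurs s (b<a , a<c)) with through (L ++ [ N ]) R (suc N) (⊆-reassoc L R s)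
... | avoiding s′ = ¬occ (occurs (⊆-unreassoc L R s′) (b<a , a<c))
... | first refl bc⊆R = <-asym a<c (below-new p (∈-++⁺ʳ L (there (lookup bc⊆R (there (here refl))))))
... | second a∈ refl _ = <-asym b<a (below-new p (∈-unreassoc L R a∈))
... | third ab⊆ refl with pair-⊆-∷ʳ L ab⊆
...   | inj₁ ab⊆L = ¬occ (occurs (++⁺ ab⊆L (refl ∷ []⊆-universal R)) (b<a , below-left p (lookup ab⊆L (here refl))))
...   | inj₂ (a∈L , refl) = <-asym b<a (below-left p a∈L)

312-preservedAfter : PreservedAfter 312-pattern
312-preservedAfter {N} {L} {R} p ¬occ (occurs s (b<c , c<a)) with through (L ++ [ N ]) R (suc N) (⊆-reassoc L R s)
... | avoiding s′ = ¬occ (occurs (⊆-unreassoc L R s′) (b<c , c<a))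
... | first refl bc⊆R =
  ¬occ (occurs (++⁺ ([]⊆-universal L) (refl ∷ bc⊆R)) (b<c , below-right p (lookup bc⊆R (there (here refl)))))
... | second _ refl c∈R = <-asym b<c (below-new p (∈-++⁺ʳ L (there c∈R)))
... | third ab⊆ refl = <-asym c<a (below-new p (∈-unreassoc L R (lookup ab⊆ (here refl))))

132-preservedAfter : PreservedAfter 132-pattern
132-preservedAfter {N} {L} {R} p ¬occ (occurs s (a<c , c<b)) with through (L ++ [ N ]) R (suc N) (⊆-reassoc L R s)
... | avoiding s′ = ¬occ (occurs (⊆-unreassoc L R s′) (a<c , c<b))
... | first refl bc⊆R = <-asym a<c (below-new p (∈-++⁺ʳ L (there (lookup bc⊆R (there (here refl))))))
... | third ab⊆ refl = <-asym c<b (below-new p (∈-unreassoc L R (lookup ab⊆ (there (here refl)))))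
... | second a∈ refl c∈R with ∈-++⁻ L a∈
...   | inj₁ a∈L = ¬occ (occurs (++⁺ (from∈ a∈L) (refl ∷ from∈ c∈R)) (a<c , below-right p c∈R))
...   | inj₂ (here refl) = <-asym a<c (below-right p c∈R)

insertBefore-avoids : ∀ {P} → PreservedBefore P → ∀ {n τ} → IsPerm (suc n) τ →
                      ¬ Occurs P τ → ¬ Occurs P (insertBefore (suc (suc n)) τ)
insertBefore-avoids preserved p ¬occ with L , R , refl ← ∈-∃++ (perm-max p)
  rewrite insertBefore-≡ L R _ (∉-left p) = preserved p ¬occ

insertAfter-avoids : ∀ {P} → PreservedAfter P → ∀ {n τ} → IsPerm (suc n) τ →
                     ¬ Occurs P τ → ¬ Occurs P (insertAfter (suc (suc n)) τ)
insertAfter-avoids preserved p ¬occ with L , R , refl ← ∈-∃++ (perm-max p)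
  rewrite insertAfter-≡ L R _ (∉-left p) = preserved p ¬occ

-- Once one pattern is avoided, the side of n + 2 on which n + 1 stands determines how n + 2 was inserted.
module _ {n : ℕ} where
  private
    N M : ℕ
    N = suc n
    M = suc N

  231-avoider-back : ∀ L R → IsPerm M (L ++ M ∷ R) → N ∈ L →
                     ¬ Occurs 231-pattern (L ++ M ∷ R) → L ++ M ∷ R ≡ back M (L ++ R)
  231-avoider-back L [] _ _ _ = cong (_++ [ M ]) (sym (++-identityʳ L))
  231-avoider-back L (y ∷ R) p N∈L ¬occ = ⊥-elim (¬occ (occurs NMy⊆ (y<N , n<1+n N)))
    where
    NMy⊆ : N ∷ M ∷ y ∷ [] ⊆ L ++ M ∷ y ∷ R
    NMy⊆ = ++⁺ (from∈ N∈L) (refl ∷ from∈ (here refl))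
    τp = perm-delete L (y ∷ R) p
    y<N : y < N
    y<N = below-max τp (∈-++⁺ʳ L (here refl)) (λ { refl → disjoint-++ L (perm-unique τp) N∈L (here refl) })

  213-avoider-insertAfter : ∀ L R → IsPerm M (L ++ M ∷ R) → N ∈ L →
                            ¬ Occurs 213-pattern (L ++ M ∷ R) → L ++ M ∷ R ≡ insertAfter M (L ++ R)
  213-avoider-insertAfter L R p N∈L ¬occ with ∈-∃++ N∈L
  ... | L₁ , [] , refl = begin
    (L₁ ++ [ N ]) ++ M ∷ R              ≡⟨ ++-assoc L₁ [ N ] (M ∷ R) ⟩
    L₁ ++ N ∷ M ∷ R                     ≡⟨ insertAfter-≡ L₁ R N (∉-left τp) ⟨
    insertAfter M (L₁ ++ N ∷ R)         ≡⟨ cong (insertAfter M) (++-assoc L₁ [ N ] R) ⟨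
    insertAfter M ((L₁ ++ [ N ]) ++ R)  ∎
    where
    open ≡-Reasoning
    τp = subst (IsPerm N) (++-assoc L₁ [ N ] R) (perm-delete (L₁ ++ [ N ]) R p)
  ... | L₁ , z ∷ L₃ , refl = ⊥-elim (¬occ (occurs NzM⊆ (z<N , n<1+n N)))
    where
    NzM⊆ : N ∷ z ∷ M ∷ [] ⊆ (L₁ ++ N ∷ z ∷ L₃) ++ M ∷ R
    NzM⊆ = ++⁺ (++⁺ ([]⊆-universal L₁) (refl ∷ refl ∷ []⊆-universal L₃)) (refl ∷ []⊆-universal R)
    τp = subst (IsPerm N) (++-assoc L₁ (N ∷ z ∷ L₃) R) (perm-delete (L₁ ++ N ∷ z ∷ L₃) R p)
    z<N : z < N
    z<N = below-right τp (here refl)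

  132-avoider-front : ∀ L R → IsPerm M (L ++ M ∷ R) → N ∈ R →
                      ¬ Occurs 132-pattern (L ++ M ∷ R) → L ++ M ∷ R ≡ front M (L ++ R)
  132-avoider-front [] R _ _ _ = refl
  132-avoider-front (x ∷ L) R p N∈R ¬occ = ⊥-elim (¬occ (occurs xMN⊆ (x<N , n<1+n N)))
    where
    xMN⊆ : x ∷ M ∷ N ∷ [] ⊆ x ∷ L ++ M ∷ R
    xMN⊆ = refl ∷ ++⁺ ([]⊆-universal L) (refl ∷ from∈ N∈R)
    τp = perm-delete (x ∷ L) R p
    x<N : x < N
    x<N = below-max τp (here refl) (λ { refl → disjoint-++ (x ∷ L) (perm-unique τp) (here refl) N∈R })

  312-avoider-insertBefore : ∀ L R → IsPerm M (L ++ M ∷ R) → N ∈ R →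
                             ¬ Occurs 312-pattern (L ++ M ∷ R) → L ++ M ∷ R ≡ insertBefore M (L ++ R)
  312-avoider-insertBefore L R p N∈R ¬occ with ∈-∃++ N∈R
  ... | [] , R₂ , refl = sym (insertBefore-≡ L R₂ N (∉-left (perm-delete L (N ∷ R₂) p)))
  ... | z ∷ R₃ , R₂ , refl = ⊥-elim (¬occ (occurs MzN⊆ (z<N , n<1+n N)))
    where
    MzN⊆ : M ∷ z ∷ N ∷ [] ⊆ L ++ M ∷ z ∷ R₃ ++ N ∷ R₂
    MzN⊆ = ++⁺ ([]⊆-universal L) (refl ∷ refl ∷ ++⁺ ([]⊆-universal R₃) (refl ∷ []⊆-universal R₂))
    τp = perm-delete L (z ∷ R₃ ++ N ∷ R₂) p
    z∉ : z ∉ R₃ ++ N ∷ R₂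
    z∉ = Unique.Unique[x∷xs]⇒x∉xs (unique-++ʳ L (perm-unique τp))
    z<N : z < N
    z<N = below-max τp (∈-++⁺ʳ L (here refl)) (λ { refl → z∉ (∈-++⁺ʳ R₃ (here refl)) })

occurs-length : ∀ {P π} → Occurs P π → 3 ≤ length π
occurs-length (occurs s _) = length-mono-≤ s

occurs-insert : ∀ {P} L R {m} → Occurs P (L ++ R) → Occurs P (L ++ m ∷ R)
occurs-insert L R (occurs s shape) = occurs (⊆-trans s (++⁺ (⊆-refl {x = L}) (_ ∷ʳ ⊆-refl))) shape

module _ (P Q : Pattern) where

  avoids-[] : Avoids P Q []
  avoids-[] = (λ o → case occurs-length o of λ ()) , (λ o → case occurs-length o of λ ())

  avoids-[1] : Avoids P Q [ 1 ]
  avoids-[1] = (λ o → case occurs-length o of λ { (s≤s ()) }) , (λ o → case occurs-length o of λ { (s≤s ()) })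

  avoids-delete : ∀ L R {m} → Avoids P Q (L ++ m ∷ R) → Avoids P Q (L ++ R)
  avoids-delete L R (¬P , ¬Q) = ¬P ∘ occurs-insert L R , ¬Q ∘ occurs-insert L R

pred-position : ∀ {n} L R → IsPerm (suc (suc n)) (L ++ suc (suc n) ∷ R) → suc n ∈ L ⊎ suc n ∈ R
pred-position L R p = ∈-++⁻ L (perm-max (perm-delete L R p))

V-scheme : MaxInsertionScheme (Avoids 132-pattern 231-pattern)
V-scheme = record
  { left = front ; right = back
  ; 𝒜-[] = avoids-[] 132-pattern 231-pattern
  ; 𝒜-[1] = avoids-[1] 132-pattern 231-pattern
  ; 𝒜-delete = avoids-delete 132-pattern 231-pattern
  ; left-inserts = front-inserts ; right-inserts = back-inserts
  ; left-𝒜 = λ p (¬132 , ¬231) →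
      front-avoids 132-pattern (inj₂ ∘ proj₁) p ¬132 , front-avoids 231-pattern (inj₁ ∘ proj₂) p ¬231
  ; right-𝒜 = λ p (¬132 , ¬231) →
      back-avoids 132-pattern (inj₂ ∘ proj₂) p ¬132 , back-avoids 231-pattern (inj₁ ∘ proj₁) p ¬231
  ; left-or-right = λ L R p (¬132 , ¬231) →
      [ (λ N∈L → inj₂ (231-avoider-back L R p N∈L ¬231))
      , (λ N∈R → inj₁ (132-avoider-front L R p N∈R ¬132)) ]′ (pred-position L R p)
  }

Λ-scheme : MaxInsertionScheme (Avoids 213-pattern 312-pattern)
Λ-scheme = record
  { left = insertBefore ; right = insertAfter
  ; 𝒜-[] = avoids-[] 213-pattern 312-pattern
  ; 𝒜-[1] = avoids-[1] 213-pattern 312-pattern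
  ; 𝒜-delete = avoids-delete 213-pattern 312-pattern
  ; left-inserts = insertBefore-inserts ; right-inserts = insertAfter-inserts
  ; left-𝒜 = λ p (¬213 , ¬312) →
      insertBefore-avoids 213-preservedBefore p ¬213 , insertBefore-avoids 312-preservedBefore p ¬312
  ; right-𝒜 = λ p (¬213 , ¬312) →
      insertAfter-avoids 213-preservedAfter p ¬213 , insertAfter-avoids 312-preservedAfter p ¬312
  ; left-or-right = λ L R p (¬213 , ¬312) →
      [ (λ N∈L → inj₂ (213-avoider-insertAfter L R p N∈L ¬213))
      , (λ N∈R → inj₁ (312-avoider-insertBefore L R p N∈R ¬312)) ]′ (pred-position L R p)
  }

A-scheme : MaxInsertionScheme (Avoids 132-pattern 213-pattern)
A-scheme = record
  { left = front ; right = insertAfter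
  ; 𝒜-[] = avoids-[] 132-pattern 213-pattern
  ; 𝒜-[1] = avoids-[1] 132-pattern 213-pattern
  ; 𝒜-delete = avoids-delete 132-pattern 213-pattern
  ; left-inserts = front-inserts ; right-inserts = insertAfter-inserts
  ; left-𝒜 = λ p (¬132 , ¬213) →
      front-avoids 132-pattern (inj₂ ∘ proj₁) p ¬132 , front-avoids 213-pattern (inj₂ ∘ proj₂) p ¬213
  ; right-𝒜 = λ p (¬132 , ¬213) →
      insertAfter-avoids 132-preservedAfter p ¬132 , insertAfter-avoids 213-preservedAfter p ¬213
  ; left-or-right = λ L R p (¬132 , ¬213) →
      [ (λ N∈L → inj₂ (213-avoider-insertAfter L R p N∈L ¬213))
      , (λ N∈R → inj₁ (132-avoider-front L R p N∈R ¬132)) ]′ (pred-position L R p)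
  }

B-scheme : MaxInsertionScheme (Avoids 231-pattern 312-pattern)
B-scheme = record
  { left = insertBefore ; right = back
  ; 𝒜-[] = avoids-[] 231-pattern 312-pattern
  ; 𝒜-[1] = avoids-[1] 231-pattern 312-pattern
  ; 𝒜-delete = avoids-delete 231-pattern 312-pattern
  ; left-inserts = insertBefore-inserts ; right-inserts = back-inserts
  ; left-𝒜 = λ p (¬231 , ¬312) →
      insertBefore-avoids 231-preservedBefore p ¬231 , insertBefore-avoids 312-preservedBefore p ¬312
  ; right-𝒜 = λ p (¬231 , ¬312) →
      back-avoids 231-pattern (inj₁ ∘ proj₁) p ¬231 , back-avoids 312-pattern (inj₁ ∘ proj₂) p ¬312
  ; left-or-right = λ L R p (¬231 , ¬312) →
      [ (λ N∈L → inj₂ (231-avoider-back L R p N∈L ¬231))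
      , (λ N∈R → inj₁ (312-avoider-insertBefore L R p N∈R ¬312)) ]′ (pred-position L R p)
  }

scheme-count : ∀ {P Q a b} → MaxInsertionScheme (Avoids P Q) → SameSet a b (word P) (word Q) →
               ∀ n k → ChCoeff n (a ∷ b ∷ []) k ≡ chCount n k
scheme-count {P} {Q} scheme (inj₁ (refl , refl)) = ChCoeff≡chCount scheme (word P ∷ word Q ∷ []) (avoids⇔ P Q)
scheme-count {P} {Q} scheme (inj₂ (refl , refl)) =
  ChCoeff≡chCount scheme (word Q ∷ word P ∷ []) (λ σ → ⇔-trans (avoids⇔ Q P σ) (mk⇔ swap swap))

InClass-count : ∀ {a b} → InClass a b → ∀ n k → ChCoeff n (a ∷ b ∷ []) k ≡ chCount n k
InClass-count (inj₁ ab) = scheme-count A-scheme ab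
InClass-count (inj₂ (inj₁ ab)) = scheme-count Λ-scheme ab
InClass-count (inj₂ (inj₂ (inj₁ ab))) = scheme-count V-scheme ab
InClass-count (inj₂ (inj₂ (inj₂ ab))) = scheme-count B-scheme ab

avoidsAllᵇ-swap : ∀ a b σ → avoidsAllᵇ (a ∷ b ∷ []) σ ≡ avoidsAllᵇ (b ∷ a ∷ []) σ
avoidsAllᵇ-swap a b σ with containsᵇ a σ | containsᵇ b σ
... | true  | true  = refl
... | true  | false = refl
... | false | true  = refl
... | false | false = refl

ChCoeff-swap : ∀ a b n k → ChCoeff n (a ∷ b ∷ []) k ≡ ChCoeff n (b ∷ a ∷ []) k
ChCoeff-swap a b n k =
  cong length (filter-≐ (wanted a b) (wanted b a) ((λ {σ} → swapped a b {σ}) , (λ {σ} → swapped b a {σ})) (S n))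
  where
  wanted : ∀ a b σ → Dec ((avoidsAllᵇ (a ∷ b ∷ []) σ ∧ (ch σ ≡ᵇ k)) ≡ true)
  wanted a b σ = (avoidsAllᵇ (a ∷ b ∷ []) σ ∧ (ch σ ≡ᵇ k)) ≟ᵇ true
  swapped : ∀ a b {σ} → (avoidsAllᵇ (a ∷ b ∷ []) σ ∧ (ch σ ≡ᵇ k)) ≡ true →
                        (avoidsAllᵇ (b ∷ a ∷ []) σ ∧ (ch σ ≡ᵇ k)) ≡ true
  swapped a b {σ} = subst (λ x → (x ∧ (ch σ ≡ᵇ k)) ≡ true) (avoidsAllᵇ-swap a b σ)

-- Separating the classes

-- These three coefficients already tell the eleven classes apart; code lists their values.
probes : List (ℕ × ℕ)
probes = (3 , 1) ∷ (4 , 2) ∷ (4 , 4) ∷ []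

signature : List Perm → List ℕ
signature Π = map (λ (n , k) → ChCoeff n Π k) probes

ChWilfEquiv⇒signature : ∀ {Π Π′} → ChWilfEquiv Π Π′ → signature Π ≡ signature Π′
ChWilfEquiv⇒signature e = map-cong (λ (n , k) → e n k) probes

data Label : Set where
  ⟨123,132⟩ ⟨123,213⟩ ⟨123,231⟩ ⟨123,312⟩ ⟨132,213⟩ ⟨132,312⟩ : Label
  ⟨132,321⟩ ⟨213,231⟩ ⟨213,321⟩ ⟨231,321⟩ ⟨312,321⟩ : Label

Members : Label → Perm → Perm → Set
Members ⟨123,132⟩ a b = SameSet a b p123 p132
Members ⟨123,213⟩ a b = SameSet a b p123 p213
Members ⟨123,231⟩ a b = SameSet a b p123 p231
Members ⟨123,312⟩ a b = SameSet a b p123 p312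
Members ⟨132,213⟩ a b = InClass a b
Members ⟨132,312⟩ a b = SameSet a b p132 p312
Members ⟨132,321⟩ a b = SameSet a b p132 p321
Members ⟨213,231⟩ a b = SameSet a b p213 p231
Members ⟨213,321⟩ a b = SameSet a b p213 p321
Members ⟨231,321⟩ a b = SameSet a b p231 p321
Members ⟨312,321⟩ a b = SameSet a b p312 p321

code : Label → List ℕ
code ⟨123,132⟩ = 1 ∷ 1 ∷ 2 ∷ []
code ⟨123,213⟩ = 2 ∷ 1 ∷ 2 ∷ []
code ⟨123,231⟩ = 2 ∷ 0 ∷ 2 ∷ []
code ⟨123,312⟩ = 1 ∷ 0 ∷ 2 ∷ []
code ⟨132,213⟩ = 1 ∷ 1 ∷ 1 ∷ []
code ⟨132,312⟩ = 0 ∷ 0 ∷ 0 ∷ []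
code ⟨132,321⟩ = 1 ∷ 2 ∷ 0 ∷ []
code ⟨213,231⟩ = 2 ∷ 0 ∷ 0 ∷ []
code ⟨213,321⟩ = 2 ∷ 2 ∷ 0 ∷ []
code ⟨231,321⟩ = 2 ∷ 2 ∷ 1 ∷ []
code ⟨312,321⟩ = 1 ∷ 2 ∷ 1 ∷ []

decode : List ℕ → Maybe Label
decode (1 ∷ 1 ∷ 2 ∷ []) = just ⟨123,132⟩
decode (2 ∷ 1 ∷ 2 ∷ []) = just ⟨123,213⟩
decode (2 ∷ 0 ∷ 2 ∷ []) = just ⟨123,231⟩
decode (1 ∷ 0 ∷ 2 ∷ []) = just ⟨123,312⟩
decode (1 ∷ 1 ∷ 1 ∷ []) = just ⟨132,213⟩
decode (0 ∷ 0 ∷ 0 ∷ []) = just ⟨132,312⟩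
decode (1 ∷ 2 ∷ 0 ∷ []) = just ⟨132,321⟩
decode (2 ∷ 0 ∷ 0 ∷ []) = just ⟨213,231⟩
decode (2 ∷ 2 ∷ 0 ∷ []) = just ⟨213,321⟩
decode (2 ∷ 2 ∷ 1 ∷ []) = just ⟨231,321⟩
decode (1 ∷ 2 ∷ 1 ∷ []) = just ⟨312,321⟩
decode _ = nothing

decode-code : ∀ L → decode (code L) ≡ just L
decode-code ⟨123,132⟩ = refl
decode-code ⟨123,213⟩ = refl
decode-code ⟨123,231⟩ = refl
decode-code ⟨123,312⟩ = refl
decode-code ⟨132,213⟩ = refl
decode-code ⟨132,312⟩ = refl
decode-code ⟨132,321⟩ = refl
decode-code ⟨213,231⟩ = refl
decode-code ⟨213,321⟩ = refl
decode-code ⟨231,321⟩ = refl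
decode-code ⟨312,321⟩ = refl

code-injective : ∀ {L L′} → code L ≡ code L′ → L ≡ L′
code-injective {L} {L′} eq =
  just-injective (trans (sym (decode-code L)) (trans (cong decode eq) (decode-code L′)))

SameSet-trans : ∀ {a b c d x y} → SameSet a b x y → SameSet c d x y → SameSet a b c d
SameSet-trans (inj₁ (refl , refl)) (inj₁ (refl , refl)) = inj₁ (refl , refl)
SameSet-trans (inj₁ (refl , refl)) (inj₂ (refl , refl)) = inj₂ (refl , refl)
SameSet-trans (inj₂ (refl , refl)) (inj₁ (refl , refl)) = inj₂ (refl , refl)
SameSet-trans (inj₂ (refl , refl)) (inj₂ (refl , refl)) = inj₁ (refl , refl)

Members-related : ∀ L {a b c d} → Members L a b → Members L c d →
                  SameSet a b c d ⊎ (InClass a b × InClass c d)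
Members-related ⟨123,132⟩ ab cd = inj₁ (SameSet-trans ab cd)
Members-related ⟨123,213⟩ ab cd = inj₁ (SameSet-trans ab cd)
Members-related ⟨123,231⟩ ab cd = inj₁ (SameSet-trans ab cd)
Members-related ⟨123,312⟩ ab cd = inj₁ (SameSet-trans ab cd)
Members-related ⟨132,213⟩ ab cd = inj₂ (ab , cd)
Members-related ⟨132,312⟩ ab cd = inj₁ (SameSet-trans ab cd)
Members-related ⟨132,321⟩ ab cd = inj₁ (SameSet-trans ab cd)
Members-related ⟨213,231⟩ ab cd = inj₁ (SameSet-trans ab cd)
Members-related ⟨213,321⟩ ab cd = inj₁ (SameSet-trans ab cd)
Members-related ⟨231,321⟩ ab cd = inj₁ (SameSet-trans ab cd)
Members-related ⟨312,321⟩ ab cd = inj₁ (SameSet-trans ab cd)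

data S₃ : Perm → Set where
  123∈ : S₃ p123
  132∈ : S₃ p132
  213∈ : S₃ p213
  231∈ : S₃ p231
  312∈ : S₃ p312
  321∈ : S₃ p321

S₃-view : ∀ {a} → a ∈ S 3 → S₃ a
S₃-view (here refl) = 123∈
S₃-view (there (here refl)) = 132∈
S₃-view (there (there (here refl))) = 213∈
S₃-view (there (there (there (here refl)))) = 231∈
S₃-view (there (there (there (there (here refl))))) = 312∈
S₃-view (there (there (there (there (there (here refl)))))) = 321∈

classify : ∀ {a b} → S₃ a → S₃ b → a ≢ b → ¬ SameSet a b p123 p321 →
           ∃ λ L → signature (a ∷ b ∷ []) ≡ code L × Members L a b
classify 123∈ 123∈ a≢b _ = ⊥-elim (a≢b refl)
classify 123∈ 132∈ _ _ = ⟨123,132⟩ , refl , inj₁ (refl , refl)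
classify 123∈ 213∈ _ _ = ⟨123,213⟩ , refl , inj₁ (refl , refl)
classify 123∈ 231∈ _ _ = ⟨123,231⟩ , refl , inj₁ (refl , refl)
classify 123∈ 312∈ _ _ = ⟨123,312⟩ , refl , inj₁ (refl , refl)
classify 123∈ 321∈ _ excluded = ⊥-elim (excluded (inj₁ (refl , refl)))
classify 132∈ 123∈ _ _ = ⟨123,132⟩ , refl , inj₂ (refl , refl)
classify 132∈ 132∈ a≢b _ = ⊥-elim (a≢b refl)
classify 132∈ 213∈ _ _ = ⟨132,213⟩ , refl , inj₁ (inj₁ (refl , refl))
classify 132∈ 231∈ _ _ = ⟨132,213⟩ , refl , inj₂ (inj₂ (inj₁ (inj₁ (refl , refl))))
classify 132∈ 312∈ _ _ = ⟨132,312⟩ , refl , inj₁ (refl , refl)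
classify 132∈ 321∈ _ _ = ⟨132,321⟩ , refl , inj₁ (refl , refl)
classify 213∈ 123∈ _ _ = ⟨123,213⟩ , refl , inj₂ (refl , refl)
classify 213∈ 132∈ _ _ = ⟨132,213⟩ , refl , inj₁ (inj₂ (refl , refl))
classify 213∈ 213∈ a≢b _ = ⊥-elim (a≢b refl)
classify 213∈ 231∈ _ _ = ⟨213,231⟩ , refl , inj₁ (refl , refl)
classify 213∈ 312∈ _ _ = ⟨132,213⟩ , refl , inj₂ (inj₁ (inj₁ (refl , refl)))
classify 213∈ 321∈ _ _ = ⟨213,321⟩ , refl , inj₁ (refl , refl)
classify 231∈ 123∈ _ _ = ⟨123,231⟩ , refl , inj₂ (refl , refl)
classify 231∈ 132∈ _ _ = ⟨132,213⟩ , refl , inj₂ (inj₂ (inj₁ (inj₂ (refl , refl))))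
classify 231∈ 213∈ _ _ = ⟨213,231⟩ , refl , inj₂ (refl , refl)
classify 231∈ 231∈ a≢b _ = ⊥-elim (a≢b refl)
classify 231∈ 312∈ _ _ = ⟨132,213⟩ , refl , inj₂ (inj₂ (inj₂ (inj₁ (refl , refl))))
classify 231∈ 321∈ _ _ = ⟨231,321⟩ , refl , inj₁ (refl , refl)
classify 312∈ 123∈ _ _ = ⟨123,312⟩ , refl , inj₂ (refl , refl)
classify 312∈ 132∈ _ _ = ⟨132,312⟩ , refl , inj₂ (refl , refl)
classify 312∈ 213∈ _ _ = ⟨132,213⟩ , refl , inj₂ (inj₁ (inj₂ (refl , refl)))
classify 312∈ 231∈ _ _ = ⟨132,213⟩ , refl , inj₂ (inj₂ (inj₂ (inj₂ (refl , refl))))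
classify 312∈ 312∈ a≢b _ = ⊥-elim (a≢b refl)
classify 312∈ 321∈ _ _ = ⟨312,321⟩ , refl , inj₁ (refl , refl)
classify 321∈ 123∈ _ excluded = ⊥-elim (excluded (inj₂ (refl , refl)))
classify 321∈ 132∈ _ _ = ⟨132,321⟩ , refl , inj₂ (refl , refl)
classify 321∈ 213∈ _ _ = ⟨213,321⟩ , refl , inj₂ (refl , refl)
classify 321∈ 231∈ _ _ = ⟨231,321⟩ , refl , inj₂ (refl , refl)
classify 321∈ 312∈ _ _ = ⟨312,321⟩ , refl , inj₂ (refl , refl)
classify 321∈ 321∈ a≢b _ = ⊥-elim (a≢b refl)

theorem2 : ∀ (a b c d : Perm) →
    a ∈ S 3 → b ∈ S 3 → a ≢ b → ¬ SameSet a b p123 p321 →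
    c ∈ S 3 → d ∈ S 3 → c ≢ d → ¬ SameSet c d p123 p321 →
    (ChWilfEquiv (a ∷ b ∷ []) (c ∷ d ∷ [])
      → (SameSet a b c d ⊎ (InClass a b × InClass c d)))
    × ((SameSet a b c d ⊎ (InClass a b × InClass c d))
      → ChWilfEquiv (a ∷ b ∷ []) (c ∷ d ∷ []))
theorem2 a b c d a∈ b∈ a≢b ab≢ c∈ d∈ c≢d cd≢ = separated , equivalent
  where
  separated : ChWilfEquiv (a ∷ b ∷ []) (c ∷ d ∷ []) → SameSet a b c d ⊎ (InClass a b × InClass c d)
  separated e with classify (S₃-view a∈) (S₃-view b∈) a≢b ab≢ | classify (S₃-view c∈) (S₃-view d∈) c≢d cd≢
  ... | L , sig-ab , ab∈L | L′ , sig-cd , cd∈L′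
    with refl ← code-injective
                  (trans (sym sig-ab) (trans (ChWilfEquiv⇒signature {a ∷ b ∷ []} {c ∷ d ∷ []} e) sig-cd)) =
    Members-related L ab∈L cd∈L′
  equivalent : SameSet a b c d ⊎ (InClass a b × InClass c d) → ChWilfEquiv (a ∷ b ∷ []) (c ∷ d ∷ [])
  equivalent (inj₁ (inj₁ (refl , refl))) n k = refl
  equivalent (inj₁ (inj₂ (refl , refl))) n k = ChCoeff-swap a b n k
  equivalent (inj₂ (ab , cd)) n k = trans (InClass-count ab n k) (sym (InClass-count cd n k))
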